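{- For every integer $n \ge 3$ we have $g_5(n) \ge 4$.
   Context: For positive integers $n$ and $k \ge 3$, $g_k(n)$ denotes the smallest integer such that for every set $A \subseteq \{1, 2, \ldots, 2n\}$ with $|A| \ge n + g_k(n)$ there exist pairwise distinct integers $b_1, \ldots, b_k$ (arbitrary integers, not required to be positive or to lie in $A$) with $b_i + b_j \in A$ for all $1 \le i < j \le k$. -}

module Defs where

open import Data.Nat using (ℕ; suc; _*_)
open import Data.Integer using (ℤ; +_; _+_; _≤_)
open import Data.Fin using (Fin; toℕ; _<_)
open import Data.Fin.Subset using (Subset; _∈_; ∣_∣)
open import Data.Product using (Σ; _×_)
open import Relation.Binary.PropositionalEquality using (_≡_)
open import Function.Definitions using (Injective)

-- A subset of {1,...,2n}: index i : Fin (2n) represents the integer i+1.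
InA : (n : ℕ) → Subset (2 * n) → ℤ → Set
InA n A m = Σ (Fin (2 * n)) λ i → (+ (suc (toℕ i)) ≡ m) × (i ∈ A)

HasSumConfig : (k n : ℕ) → Subset (2 * n) → Set
HasSumConfig k n A = Σ (Fin k → ℤ) λ b →
  Injective _≡_ _≡_ b × (∀ i j → i < j → InA n A (b i + b j))

-- g "works" for (k, n): every A ⊆ {1..2n} with |A| ≥ n + g has the configuration.
-- g_k(n) is the smallest integer g such that Works k n g.
Works : ℕ → ℕ → ℤ → Set
Works k n g = ∀ (A : Subset (2 * n)) → (+ n) + g ≤ + ∣ A ∣ → HasSumConfig k n A

-- The set A of odd numbers in [1, 2n] together with 2, 4 and 2n has n + 3 elements.
-- Suppose b₁, …, b₅ are distinct with all pairwise sums in A. Three of them, x < y < z,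
-- share a parity, so x + y < x + z < y + z are even elements of A, i.e. lie in {2, 4, 2n},
-- which forces x + y = 2 and y + z = 2n. Every bₗ other than x, z satisfies 1 ≤ x + bₗ and
-- bₗ + z ≤ 2n = y + z, hence x + bₗ ∈ {1, 2}. So l ↦ x + bₗ maps the five indices
-- injectively into {2x, x + z, 1, 2}, which is impossible.

module Submission where

open import Data.Nat using (ℕ)
open import Data.Integer using (ℤ; +_)
open import Defs

open import Level using (Level; 0ℓ)
open import Data.Empty using (⊥)
open import Data.Bool.Base using (true; T)
open import Data.Unit.Base using (tt)
open import Data.Nat.Base as ℕ using (zero; suc; parity; z≤n; s≤s; _*_)
import Data.Nat.Properties as ℕ
open import Data.Integer.Base as ℤ using (-[1+_]; _⊖_; +≤+; +<+)
import Data.Integer.Properties as ℤ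
open import Data.Parity.Base as ℙ using (Parity; 0ℙ; 1ℙ)
import Data.Parity.Properties as ℙ
open import Data.Fin as Fin using (Fin; toℕ; fromℕ<; #_)
import Data.Fin.Properties as Fin
open import Data.Fin.Subset using (Subset; _∈_; _∉_; _⊆_; ∣_∣)
open import Data.Fin.Subset.Properties using (p⊂q⇒∣p∣<∣q∣)
open import Data.Vec.Base using (Vec; []; _∷_; tabulate; lookup)
open import Data.Vec.Properties using (lookup∘tabulate; []=⇒lookup; lookup⇒[]=)
open import Data.Product.Base using (∃-syntax; _×_; _,_; proj₁; proj₂)
open import Data.Sum.Base using (_⊎_; inj₁; inj₂)
open import Function.Base using (_∘_)
open import Function.Definitions using (Injective)
open import Relation.Binary.Definitions using (Tri; tri<; tri≈; tri>)
open import Relation.Binary.PropositionalEquality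
open import Relation.Nullary using (¬_; does; yes; no; contradiction)
open import Relation.Nullary.Decidable using (True; isYes; toWitness; dec-true; isYes≗does)
open import Relation.Unary using (Pred; Decidable; _∪_; ｛_｝)
open import Relation.Unary.Properties using (_∪?_)
open import Algebra.Properties.AbelianGroup ℤ.+-0-abelianGroup using (∙-cancelˡ)

private variable
  ℓ : Level

parityℤ : ℤ → Parity
parityℤ (+ n)    = parity n
parityℤ -[1+ n ] = parity (suc n)

parity-suc-+-suc : ∀ m n → parity (suc m) ℙ.+ parity (suc n) ≡ parity (m ℕ.+ n)
parity-suc-+-suc m n = begin
  parity (suc m) ℙ.+ parity (suc n) ≡⟨ ℙ.+-homo-+ (suc m) (suc n) ⟨
  parity (suc m ℕ.+ suc n)          ≡⟨ cong (parity ∘ suc) (ℕ.+-suc m n) ⟩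
  parity (m ℕ.+ n)                  ∎
  where open ≡-Reasoning

parityℤ-⊖ : ∀ m n → parityℤ (m ⊖ n) ≡ parity m ℙ.+ parity n
parityℤ-⊖ m       zero    = sym (ℙ.+-identityʳ (parity m))
parityℤ-⊖ zero    (suc n) = refl
parityℤ-⊖ (suc m) (suc n) = begin
  parityℤ (suc m ⊖ suc n)           ≡⟨ cong parityℤ (ℤ.[1+m]⊖[1+n]≡m⊖n m n) ⟩
  parityℤ (m ⊖ n)                   ≡⟨ parityℤ-⊖ m n ⟩
  parity m ℙ.+ parity n             ≡⟨ ℙ.+-homo-+ m n ⟨
  parity (m ℕ.+ n)                  ≡⟨ parity-suc-+-suc m n ⟨
  parity (suc m) ℙ.+ parity (suc n) ∎
  where open ≡-Reasoning

parityℤ-+ : ∀ x y → parityℤ (x ℤ.+ y) ≡ parityℤ x ℙ.+ parityℤ y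
parityℤ-+ (+ m)    (+ n)    = ℙ.+-homo-+ m n
parityℤ-+ (+ m)    -[1+ n ] = parityℤ-⊖ m (suc n)
parityℤ-+ -[1+ m ] (+ n)    = trans (parityℤ-⊖ n (suc m)) (ℙ.+-comm (parity n) _)
parityℤ-+ -[1+ m ] -[1+ n ] = sym (parity-suc-+-suc m n)

parityℤ-+-same : ∀ {x y} → parityℤ x ≡ parityℤ y → parityℤ (x ℤ.+ y) ≡ 0ℙ
parityℤ-+-same {x} {y} x≡y = begin
  parityℤ (x ℤ.+ y)         ≡⟨ parityℤ-+ x y ⟩
  parityℤ x ℙ.+ parityℤ y   ≡⟨ cong (ℙ._+ parityℤ y) x≡y ⟩
  parityℤ y ℙ.+ parityℤ y   ≡⟨ ℙ.p+p≡0ℙ (parityℤ y) ⟩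
  0ℙ                        ∎
  where open ≡-Reasoning

record ThreeOf (P : Pred (Fin 5) ℓ) : Set ℓ where
  constructor three
  field
    {i j k} : Fin 5
    i<j : i Fin.< j
    j<k : j Fin.< k
    Pᵢ : P i
    Pⱼ : P j
    Pₖ : P k

  i≢j : i ≢ j
  i≢j = Fin.<⇒≢ i<j

  j≢k : j ≢ k
  j≢k = Fin.<⇒≢ j<k

  i≢k : i ≢ k
  i≢k = Fin.<⇒≢ (Fin.<-trans i<j j<k)

threeOf : ∀ {P : Pred (Fin 5) ℓ} i j k {i<j : True (i Fin.<? j)} {j<k : True (j Fin.<? k)} →
          P i → P j → P k → ThreeOf P
threeOf i j k {i<j} {j<k} = three (toWitness i<j) (toWitness j<k)

monochromaticTriple : (c : Fin 5 → Parity) → ∃[ p ] ThreeOf (λ l → c l ≡ p)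
monochromaticTriple c with c (# 0) in e₀ | c (# 1) in e₁ | c (# 2) in e₂ | c (# 3) in e₃ | c (# 4) in e₄
... | 0ℙ | 0ℙ | 0ℙ | _  | _  = _ , threeOf (# 0) (# 1) (# 2) e₀ e₁ e₂
... | 1ℙ | 1ℙ | 1ℙ | _  | _  = _ , threeOf (# 0) (# 1) (# 2) e₀ e₁ e₂
... | 0ℙ | 0ℙ | 1ℙ | 0ℙ | _  = _ , threeOf (# 0) (# 1) (# 3) e₀ e₁ e₃
... | 0ℙ | 0ℙ | 1ℙ | 1ℙ | 0ℙ = _ , threeOf (# 0) (# 1) (# 4) e₀ e₁ e₄
... | 0ℙ | 0ℙ | 1ℙ | 1ℙ | 1ℙ = _ , threeOf (# 2) (# 3) (# 4) e₂ e₃ e₄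
... | 1ℙ | 1ℙ | 0ℙ | 1ℙ | _  = _ , threeOf (# 0) (# 1) (# 3) e₀ e₁ e₃
... | 1ℙ | 1ℙ | 0ℙ | 0ℙ | 1ℙ = _ , threeOf (# 0) (# 1) (# 4) e₀ e₁ e₄
... | 1ℙ | 1ℙ | 0ℙ | 0ℙ | 0ℙ = _ , threeOf (# 2) (# 3) (# 4) e₂ e₃ e₄
... | 0ℙ | 1ℙ | 0ℙ | 0ℙ | _  = _ , threeOf (# 0) (# 2) (# 3) e₀ e₂ e₃
... | 0ℙ | 1ℙ | 0ℙ | 1ℙ | 0ℙ = _ , threeOf (# 0) (# 2) (# 4) e₀ e₂ e₄
... | 0ℙ | 1ℙ | 0ℙ | 1ℙ | 1ℙ = _ , threeOf (# 1) (# 3) (# 4) e₁ e₃ e₄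
... | 1ℙ | 0ℙ | 1ℙ | 1ℙ | _  = _ , threeOf (# 0) (# 2) (# 3) e₀ e₂ e₃
... | 1ℙ | 0ℙ | 1ℙ | 0ℙ | 1ℙ = _ , threeOf (# 0) (# 2) (# 4) e₀ e₂ e₄
... | 1ℙ | 0ℙ | 1ℙ | 0ℙ | 0ℙ = _ , threeOf (# 1) (# 3) (# 4) e₁ e₃ e₄
... | 1ℙ | 0ℙ | 0ℙ | 0ℙ | _  = _ , threeOf (# 1) (# 2) (# 3) e₁ e₂ e₃
... | 1ℙ | 0ℙ | 0ℙ | 1ℙ | 0ℙ = _ , threeOf (# 1) (# 2) (# 4) e₁ e₂ e₄
... | 1ℙ | 0ℙ | 0ℙ | 1ℙ | 1ℙ = _ , threeOf (# 0) (# 3) (# 4) e₀ e₃ e₄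
... | 0ℙ | 1ℙ | 1ℙ | 1ℙ | _  = _ , threeOf (# 1) (# 2) (# 3) e₁ e₂ e₃
... | 0ℙ | 1ℙ | 1ℙ | 0ℙ | 1ℙ = _ , threeOf (# 1) (# 2) (# 4) e₁ e₂ e₄
... | 0ℙ | 1ℙ | 1ℙ | 0ℙ | 0ℙ = _ , threeOf (# 0) (# 3) (# 4) e₀ e₃ e₄

injective∧covered⇒≤ : ∀ {a} {A : Set a} {m n} {f : Fin m → A} (g : Fin n → A) →
                      Injective _≡_ _≡_ f → (∀ i → ∃[ t ] g t ≡ f i) → m ℕ.≤ n
injective∧covered⇒≤ {f = f} g f-inj cover = Fin.injective⇒≤ label-inj
  where
  label-inj : Injective _≡_ _≡_ (proj₁ ∘ cover)
  label-inj {i} {j} tᵢ≡tⱼ = f-inj (begin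
    f i                 ≡⟨ proj₂ (cover i) ⟨
    g (proj₁ (cover i)) ≡⟨ cong g tᵢ≡tⱼ ⟩
    g (proj₁ (cover j)) ≡⟨ proj₂ (cover j) ⟩
    f j                 ∎)
    where open ≡-Reasoning

subsetOf : {P : Pred ℕ ℓ} → Decidable P → (k : ℕ) → Subset k
subsetOf P? k = tabulate (λ i → does (P? (suc (toℕ i))))

module _ {P : Pred ℕ ℓ} (P? : Decidable P) {k : ℕ} {i : Fin k} where

  ∈-subsetOf⁻ : i ∈ subsetOf P? k → P (suc (toℕ i))
  ∈-subsetOf⁻ i∈ = toWitness (subst T (sym isYes≡true) tt)
    where
    open ≡-Reasoning
    isYes≡true : isYes (P? (suc (toℕ i))) ≡ true
    isYes≡true = begin
      isYes (P? (suc (toℕ i))) ≡⟨ isYes≗does (P? _) ⟩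
      does (P? (suc (toℕ i)))  ≡⟨ lookup∘tabulate _ i ⟨
      lookup (subsetOf P? k) i ≡⟨ []=⇒lookup i∈ ⟩
      true                     ∎

  ∈-subsetOf⁺ : P (suc (toℕ i)) → i ∈ subsetOf P? k
  ∈-subsetOf⁺ p = lookup⇒[]= i _ (trans (lookup∘tabulate _ i) (dec-true (P? _) p))

∣subsetOf∣<∣subsetOf-∪｛｝∣ : ∀ {P : Pred ℕ ℓ} (P? : Decidable P) {k t} → ¬ P (suc t) → t ℕ.< k →
                              ∣ subsetOf P? k ∣ ℕ.< ∣ subsetOf (P? ∪? (suc t ℕ.≟_)) k ∣
∣subsetOf∣<∣subsetOf-∪｛｝∣ {P = P} P? {k} {t} ¬Pt t<k = p⊂q⇒∣p∣<∣q∣ (p⊆q , new , new∈q , new∉p)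
  where
  Q? : Decidable (P ∪ ｛ suc t ｝)
  Q? = P? ∪? (suc t ℕ.≟_)
  new : Fin k
  new = fromℕ< t<k
  t≡new : suc t ≡ suc (toℕ new)
  t≡new = cong suc (sym (Fin.toℕ-fromℕ< t<k))
  p⊆q : subsetOf P? k ⊆ subsetOf Q? k
  p⊆q x∈ = ∈-subsetOf⁺ Q? (inj₁ (∈-subsetOf⁻ P? x∈))
  new∈q : new ∈ subsetOf Q? k
  new∈q = ∈-subsetOf⁺ Q? (inj₂ t≡new)
  new∉p : new ∉ subsetOf P? k
  new∉p new∈ = ¬Pt (subst P (sym t≡new) (∈-subsetOf⁻ P? new∈))

Odd : Pred ℕ _
Odd m = parity m ≡ 1ℙ

Odd? : Decidable Odd
Odd? m = parity m ℙ.≟ 1ℙ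

∣subsetOf-Odd∣ : ∀ n → ∣ subsetOf Odd? (2 * n) ∣ ≡ n
∣subsetOf-Odd∣ zero    = refl
∣subsetOf-Odd∣ (suc n) =
  subst (λ m → ∣ subsetOf Odd? m ∣ ≡ suc n) (sym (ℕ.*-suc 2 n)) (cong suc (∣subsetOf-Odd∣ n))

odd∪｛2,4,2n｝? : ∀ n → Decidable (((Odd ∪ ｛ 2 ｝) ∪ ｛ 4 ｝) ∪ ｛ 2 * n ｝)
odd∪｛2,4,2n｝? n = ((Odd? ∪? (2 ℕ.≟_)) ∪? (4 ℕ.≟_)) ∪? (2 * n ℕ.≟_)

odds∪｛2,4,2n｝ : (n : ℕ) → Subset (2 * n)
odds∪｛2,4,2n｝ n = subsetOf (odd∪｛2,4,2n｝? n) (2 * n)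

-- Matching n as a successor makes 2 * n reduce to the form suc t in which the last step
-- adds the element 2n.
n+3≤∣odds∪｛2,4,2n｝∣ : ∀ {n} → 3 ℕ.≤ n → n ℕ.+ 3 ℕ.≤ ∣ odds∪｛2,4,2n｝ n ∣
n+3≤∣odds∪｛2,4,2n｝∣ {n@(suc _)} 3≤n = begin
  n ℕ.+ 3                    ≡⟨ ℕ.+-comm n 3 ⟩
  3 ℕ.+ n                    ≡⟨ cong (3 ℕ.+_) (∣subsetOf-Odd∣ n) ⟨
  3 ℕ.+ ∣ subsetOf Odd? 2n ∣ ≤⟨ s≤s (s≤s (∣subsetOf∣<∣subsetOf-∪｛｝∣ Odd? (λ ()) 1<2n)) ⟩
  2 ℕ.+ ∣ subsetOf P₁? 2n ∣  ≤⟨ s≤s (∣subsetOf∣<∣subsetOf-∪｛｝∣ P₁? ¬P₁4 3<2n) ⟩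
  1 ℕ.+ ∣ subsetOf P₂? 2n ∣  ≤⟨ ∣subsetOf∣<∣subsetOf-∪｛｝∣ P₂? ¬P₂2n ℕ.≤-refl ⟩
  ∣ odds∪｛2,4,2n｝ n ∣        ∎
  where
  open ℕ.≤-Reasoning
  2n : ℕ
  2n = 2 * n
  P₁? : Decidable (Odd ∪ ｛ 2 ｝)
  P₁? = Odd? ∪? (2 ℕ.≟_)
  P₂? : Decidable ((Odd ∪ ｛ 2 ｝) ∪ ｛ 4 ｝)
  P₂? = P₁? ∪? (4 ℕ.≟_)
  6≤2n : 6 ℕ.≤ 2n
  6≤2n = ℕ.*-monoʳ-≤ 2 3≤n
  1<2n : 1 ℕ.< 2n
  1<2n = ℕ.≤-trans (s≤s (s≤s z≤n)) 6≤2n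
  3<2n : 3 ℕ.< 2n
  3<2n = ℕ.≤-trans (s≤s (s≤s (s≤s (s≤s z≤n)))) 6≤2n
  ¬P₁4 : ¬ (Odd ∪ ｛ 2 ｝) 4
  ¬P₁4 (inj₁ ())
  ¬P₁4 (inj₂ ())
  ¬P₂2n : ¬ ((Odd ∪ ｛ 2 ｝) ∪ ｛ 4 ｝) 2n
  ¬P₂2n (inj₁ (inj₁ odd)) = contradiction (trans (sym (ℙ.*-homo-* 2 n)) odd) λ ()
  ¬P₂2n (inj₁ (inj₂ 2≡2n)) =
    contradiction (subst (6 ℕ.≤_) (sym 2≡2n) 6≤2n) λ { (s≤s (s≤s ())) }
  ¬P₂2n (inj₂ 4≡2n) =
    contradiction (subst (6 ℕ.≤_) (sym 4≡2n) 6≤2n) λ { (s≤s (s≤s (s≤s (s≤s ())))) }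

InA-bounds : ∀ {n A s} → InA n A s → + 1 ℤ.≤ s × s ℤ.≤ + (2 * n)
InA-bounds (i , refl , _) = +≤+ (s≤s z≤n) , +≤+ (Fin.toℕ<n i)

data ｛2,4,2n｝ (n : ℕ) : Pred ℤ 0ℓ where
  two  : ｛2,4,2n｝ n (+ 2)
  four : ｛2,4,2n｝ n (+ 4)
  top  : ｛2,4,2n｝ n (+ (2 * n))

even∈odds∪｛2,4,2n｝ : ∀ {n s} → InA n (odds∪｛2,4,2n｝ n) s → parityℤ s ≡ 0ℙ → ｛2,4,2n｝ n s
even∈odds∪｛2,4,2n｝ {n} (i , refl , i∈) even
  with ∈-subsetOf⁻ (odd∪｛2,4,2n｝? n) i∈
... | inj₁ (inj₁ (inj₁ odd)) = contradiction (trans (sym even) odd) λ ()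
... | inj₁ (inj₁ (inj₂ 2≡)) = subst (｛2,4,2n｝ n ∘ +_) 2≡ two
... | inj₁ (inj₂ 4≡)        = subst (｛2,4,2n｝ n ∘ +_) 4≡ four
... | inj₂ 2n≡              = subst (｛2,4,2n｝ n ∘ +_) 2n≡ top

increasing-｛2,4,2n｝ : ∀ {n s₁ s₂ s₃} → ｛2,4,2n｝ n s₁ → ｛2,4,2n｝ n s₂ → ｛2,4,2n｝ n s₃ →
                       s₁ ℤ.< s₂ → s₂ ℤ.< s₃ → s₃ ℤ.≤ + (2 * n) → s₁ ≡ + 2 × s₃ ≡ + (2 * n)
increasing-｛2,4,2n｝ top  _    _    p q r = contradiction (ℤ.<-≤-trans (ℤ.<-trans p q) r) (ℤ.<-irrefl refl)
increasing-｛2,4,2n｝ _    top  _    _ q r = contradiction (ℤ.<-≤-trans q r) (ℤ.<-irrefl refl)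
increasing-｛2,4,2n｝ two  two  _    (+<+ (s≤s (s≤s ()))) _ _
increasing-｛2,4,2n｝ four two  _    (+<+ (s≤s (s≤s ()))) _ _
increasing-｛2,4,2n｝ four four _    (+<+ (s≤s (s≤s (s≤s (s≤s ()))))) _ _
increasing-｛2,4,2n｝ two  four two  _ (+<+ (s≤s (s≤s ()))) _
increasing-｛2,4,2n｝ two  four four _ (+<+ (s≤s (s≤s (s≤s (s≤s ()))))) _
increasing-｛2,4,2n｝ two  four top  _ _ _ = refl , refl

1≤x≤2⇒x≡1⊎x≡2 : ∀ {x} → + 1 ℤ.≤ x → x ℤ.≤ + 2 → x ≡ + 1 ⊎ x ≡ + 2
1≤x≤2⇒x≡1⊎x≡2 {+ 1}                   _        _ = inj₁ refl
1≤x≤2⇒x≡1⊎x≡2 {+ 2}                   _        _ = inj₂ refl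
1≤x≤2⇒x≡1⊎x≡2 {+ 0}                   (+≤+ ()) _
1≤x≤2⇒x≡1⊎x≡2 {+ suc (suc (suc _))}   _        (+≤+ (s≤s (s≤s ())))

module _ {n : ℕ} {b : Fin 5 → ℤ} (b-inj : Injective _≡_ _≡_ b)
         (b-sums : ∀ i j → i Fin.< j → InA n (odds∪｛2,4,2n｝ n) (b i ℤ.+ b j)) where

  private
    A : Subset (2 * n)
    A = odds∪｛2,4,2n｝ n

  sum∈A : ∀ {i j} → i ≢ j → InA n A (b i ℤ.+ b j)
  sum∈A {i} {j} i≢j with Fin.<-cmp i j
  ... | tri< i<j _ _ = b-sums i j i<j
  ... | tri≈ _ i≡j _ = contradiction i≡j i≢j
  ... | tri> _ _ j<i = subst (InA n A) (ℤ.+-comm (b j) (b i)) (b-sums j i j<i)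

  sum-bounds : ∀ {i j} → i ≢ j → + 1 ℤ.≤ b i ℤ.+ b j × b i ℤ.+ b j ℤ.≤ + (2 * n)
  sum-bounds i≢j = InA-bounds {n = n} (sum∈A i≢j)

  sameParity⇒sum∈｛2,4,2n｝ : ∀ {i j} → i ≢ j → parityℤ (b i) ≡ parityℤ (b j) →
                             ｛2,4,2n｝ n (b i ℤ.+ b j)
  sameParity⇒sum∈｛2,4,2n｝ {i} {j} i≢j same =
    even∈odds∪｛2,4,2n｝ {n = n} (sum∈A i≢j) (parityℤ-+-same {b i} {b j} same)

  record IncreasingTriple (P : Pred (Fin 5) ℓ) : Set ℓ where
    constructor increasing
    field
      {i j k} : Fin 5
      bᵢ<bⱼ : b i ℤ.< b j
      bⱼ<bₖ : b j ℤ.< b k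
      Pᵢ : P i
      Pⱼ : P j
      Pₖ : P k

  insert : ∀ {P : Pred (Fin 5) ℓ} {lo hi m} → b lo ℤ.< b hi → lo ≢ m → hi ≢ m →
           P lo → P hi → P m → IncreasingTriple P
  insert {lo = lo} {hi} {m} lo<hi lo≢m hi≢m Plo Phi Pm
    with ℤ.<-cmp (b m) (b lo) | ℤ.<-cmp (b m) (b hi)
  ... | tri< m<lo _ _ | _             = increasing m<lo lo<hi Pm Plo Phi
  ... | tri≈ _ m≡lo _ | _             = contradiction (sym (b-inj m≡lo)) lo≢m
  ... | tri> _ _ lo<m | tri< m<hi _ _ = increasing lo<m m<hi Plo Pm Phi
  ... | tri> _ _ _    | tri≈ _ m≡hi _ = contradiction (sym (b-inj m≡hi)) hi≢m
  ... | tri> _ _ _    | tri> _ _ hi<m = increasing lo<hi hi<m Plo Phi Pm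

  sortThree : ∀ {P : Pred (Fin 5) ℓ} → ThreeOf P → IncreasingTriple P
  sortThree {P = P} t = sortPair (ℤ.<-cmp (b i) (b j))
    where
    open ThreeOf t
    sortPair : Tri (b i ℤ.< b j) (b i ≡ b j) (b j ℤ.< b i) → IncreasingTriple P
    sortPair (tri< bᵢ<bⱼ _ _) = insert bᵢ<bⱼ i≢k j≢k Pᵢ Pⱼ Pₖ
    sortPair (tri≈ _ bᵢ≡bⱼ _) = contradiction (b-inj bᵢ≡bⱼ) i≢j
    sortPair (tri> _ _ bⱼ<bᵢ) = insert bⱼ<bᵢ j≢k i≢k Pⱼ Pᵢ Pₖ

  increasingSameParity⇒⊥ : ∀ {p} → IncreasingTriple (λ l → parityℤ (b l) ≡ p) → ⊥
  increasingSameParity⇒⊥ (increasing {i} {j} {k} x<y y<z Pᵢ Pⱼ Pₖ) =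
    ℕ.<-irrefl refl (injective∧covered⇒≤ (lookup values) x+b-injective cover)
    where
    x y z : ℤ
    x = b i
    y = b j
    z = b k
    <⇒≢ : ∀ {l l′} → b l ℤ.< b l′ → l ≢ l′
    <⇒≢ bₗ<bₗ′ l≡l′ = ℤ.<-irrefl (cong b l≡l′) bₗ<bₗ′
    x+y≡2×y+z≡2n : x ℤ.+ y ≡ + 2 × y ℤ.+ z ≡ + (2 * n)
    x+y≡2×y+z≡2n = increasing-｛2,4,2n｝
      (sameParity⇒sum∈｛2,4,2n｝ (<⇒≢ x<y) (trans Pᵢ (sym Pⱼ)))
      (sameParity⇒sum∈｛2,4,2n｝ (<⇒≢ (ℤ.<-trans x<y y<z)) (trans Pᵢ (sym Pₖ)))
      (sameParity⇒sum∈｛2,4,2n｝ (<⇒≢ y<z) (trans Pⱼ (sym Pₖ)))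
      (ℤ.+-monoʳ-< x y<z) (ℤ.+-monoˡ-< z x<y) (proj₂ (sum-bounds (<⇒≢ y<z)))
    window : ∀ l → i ≢ l → l ≢ k → x ℤ.+ b l ≡ + 1 ⊎ x ℤ.+ b l ≡ + 2
    window l i≢l l≢k = 1≤x≤2⇒x≡1⊎x≡2 (proj₁ (sum-bounds i≢l))
      (ℤ.≤-trans (ℤ.+-monoʳ-≤ x bₗ≤y) (ℤ.≤-reflexive (proj₁ x+y≡2×y+z≡2n)))
      where
      bₗ+z≤y+z : b l ℤ.+ z ℤ.≤ y ℤ.+ z
      bₗ+z≤y+z = subst (b l ℤ.+ z ℤ.≤_) (sym (proj₂ x+y≡2×y+z≡2n)) (proj₂ (sum-bounds l≢k))
      bₗ≤y : b l ℤ.≤ y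
      bₗ≤y = ℤ.≮⇒≥ λ y<bₗ → ℤ.<-irrefl refl (ℤ.<-≤-trans (ℤ.+-monoˡ-< z y<bₗ) bₗ+z≤y+z)
    values : Vec ℤ 4
    values = x ℤ.+ x ∷ x ℤ.+ z ∷ + 1 ∷ + 2 ∷ []
    cover : ∀ l → ∃[ t ] lookup values t ≡ x ℤ.+ b l
    cover l with i Fin.≟ l | l Fin.≟ k
    ... | yes refl | _        = # 0 , refl
    ... | no _     | yes refl = # 1 , refl
    ... | no i≢l   | no l≢k   with window l i≢l l≢k
    ...   | inj₁ x+bₗ≡1 = # 2 , sym x+bₗ≡1
    ...   | inj₂ x+bₗ≡2 = # 3 , sym x+bₗ≡2
    x+b-injective : Injective _≡_ _≡_ (λ l → x ℤ.+ b l)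
    x+b-injective eq = b-inj (∙-cancelˡ x _ _ eq)

  noFiveConfiguration : ⊥
  noFiveConfiguration =
    increasingSameParity⇒⊥ (sortThree (proj₂ (monochromaticTriple (parityℤ ∘ b))))

odds∪｛2,4,2n｝-hasNoSumConfig : ∀ n → ¬ HasSumConfig 5 n (odds∪｛2,4,2n｝ n)
odds∪｛2,4,2n｝-hasNoSumConfig n (b , b-inj , b-sums) = noFiveConfiguration {n = n} b-inj b-sums

theorem6 : ∀ (n : ℕ) → 3 Data.Nat.≤ n → ∀ (g : ℤ) → Works 5 n g → + 4 Data.Integer.≤ g
theorem6 n 3≤n g works = ℤ.≮⇒≥ λ g<4 →
  odds∪｛2,4,2n｝-hasNoSumConfig n (works (odds∪｛2,4,2n｝ n) (n+g≤∣A∣ g<4))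
  where
  n+g≤∣A∣ : g ℤ.< + 4 → + n ℤ.+ g ℤ.≤ + ∣ odds∪｛2,4,2n｝ n ∣
  n+g≤∣A∣ g<4 =
    ℤ.≤-trans (ℤ.+-monoʳ-≤ (+ n) (ℤ.i<j⇒i≤pred[j] g<4)) (+≤+ (n+3≤∣odds∪｛2,4,2n｝∣ 3≤n))
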